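{- Every $\lambda^\star$-practical number is $\lambda$-practical.
   Context: $\lambda$ is the Carmichael function ($\lambda(n)$ is the least positive $m$ with $a^m\equiv1 \pmod n$ for all $a$ coprime to $n$) and $\varphi$ is Euler's totient function. A positive integer $n$ is $\lambda^\star$-practical if every positive integer $m\le S_\lambda(n)=\sum_{d\mid n}\lambda(d)$ can be written as $\sum_{d\in\mathcal{D}}\lambda(d)$ for some set $\mathcal{D}$ of divisors of $n$. A positive integer $n$ is $\lambda$-practical if every integer $m$ with $1\le m\le n$ can be written as $m=\sum_{d\mid n}\lambda(d)m_d$ with integers $0\le m_d\le \varphi(d)/\lambda(d)$. -}

module Defs where

open import Data.Nat using (ℕ; zero; suc; _+_; _*_; _^_; _≤_; _≡ᵇ_)
open import Data.Nat.DivMod using (_%_; _/_)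
open import Data.Nat.GCD using (gcd)
open import Data.Nat.Divisibility using (_∣?_)
open import Data.Bool using (Bool; true; false; not; _∨_)
open import Data.Maybe using (fromMaybe)
open import Data.List using (List; map; upTo; filter; filterᵇ; findᵇ; length)
open import Data.Bool.ListAction using (and)
open import Data.Nat.ListAction using (sum)
open import Data.List.Membership.Propositional using (_∈_)
open import Data.List.Relation.Binary.Sublist.Propositional using (_⊆_)
open import Data.Product using (Σ; _×_)
open import Relation.Binary.PropositionalEquality using (_≡_)

range1 : ℕ → List ℕ
range1 n = map suc (upTo n)

-- total versions of mod / div (divisor 0 never arises in the uses below)
_mod_ : ℕ → ℕ → ℕ
m mod zero    = m
m mod (suc k) = m % suc k

_div_ : ℕ → ℕ → ℕ
m div zero    = zero
m div (suc k) = m / suc k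

coprimeᵇ : ℕ → ℕ → Bool
coprimeᵇ a n = gcd a n ≡ᵇ 1

φ : ℕ → ℕ
φ n = length (filterᵇ (λ k → coprimeᵇ k n) (range1 n))

-- a^m ≡ 1 (mod n) for every a coprime to n (checking residues 1..n suffices)
carmichaelExp : ℕ → ℕ → Bool
carmichaelExp n m =
  and (map (λ a → not (coprimeᵇ a n) ∨ ((a ^ m) mod n ≡ᵇ 1 mod n)) (range1 n))

-- Carmichael function: least m ≥ 1 with a^m ≡ 1 (mod n) for all a coprime to n.
-- The search over 1..n is exhaustive since λ(n) ≤ φ(n) ≤ n for n ≥ 1.
λc : ℕ → ℕ
λc n = fromMaybe 0 (findᵇ (carmichaelExp n) (range1 n))

divisors : ℕ → List ℕ
divisors n = filter (_∣? n) (range1 n)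

Sλ : ℕ → ℕ
Sλ n = sum (map λc (divisors n))

-- λ*-practical: every 1 ≤ m ≤ S_λ(n) is Σ_{d ∈ D} λ(d) for a set D of divisors of n
-- (a set of divisors = a sublist of the duplicate-free list of divisors)
λ⋆-practical : ℕ → Set
λ⋆-practical n =
  (m : ℕ) → 1 ≤ m → m ≤ Sλ n →
  Σ (List ℕ) (λ D → (D ⊆ divisors n) × (sum (map λc D) ≡ m))

λ-practical : ℕ → Set
λ-practical n =
  (m : ℕ) → 1 ≤ m → m ≤ n →
  Σ (ℕ → ℕ) (λ c →
     ((d : ℕ) → d ∈ divisors n → c d ≤ φ d div λc d) ×
     (m ≡ sum (map (λ d → λc d * c d) (divisors n))))

-- Call m a universal exponent modulo d if a^m ≡ 1 (mod d) for every a coprime to d. Universal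
-- exponents are closed under taking remainders and, by Euler's theorem, φ(d) is one; hence the least
-- one, λ(d), divides φ(d), and we may put k(d) = φ(d)/λ(d). Writing each k/n (1 ≤ k ≤ n) in lowest
-- terms u/g, with g ∣ n and u a totative of g, gives n ≤ Σ_{d∣n} φ(d) = Σ_{d∣n} λ(d) k(d).
-- A λ*-practical n represents every m ≤ S_λ(n) with coefficients in {0, 1}. Raising the bound on the
-- coefficient of one divisor e by one extends the representable range by λ(e) ≤ S_λ(n), so no gap
-- opens; raising every bound to k(d) therefore represents every m ≤ Σ_{d∣n} λ(d) k(d), hence every m ≤ n.

module Submission where

open import Defs
open import Data.Nat
  using (ℕ; zero; suc; _+_; _*_; _∸_; _^_; _≤_; _<_; z≤n; s≤s; _≟_; _≤?_; _≡ᵇ_)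
open import Data.Nat using (NonZero; >-nonZero; >-nonZero⁻¹; ≢-nonZero; ≢-nonZero⁻¹)
open import Data.Nat.Properties
open import Data.Nat.ListAction using (sum; product)
open import Data.Nat.ListAction.Properties using (product-↭)
open import Data.Nat.DivMod
  using (_%_; _/_; m≡m%n+[m/n]*n; %-distribˡ-*; m%n%n≡m%n; m<n⇒m%n≡m; m%n<n; m%n≤n; n%1≡0; m/n*n≡m; m*n/n≡m; m*[n/m]≡n)
open import Data.Nat.Divisibility
  using (_∣_; _∣?_; divides; ∣⇒≤; ∣-refl; ∣m⇒∣m*n; ∣n∣m%n⇒∣m; n∣m⇒m%n≡0; m%n≡0⇒n∣m)
open import Data.Nat.GCD using (gcd; gcd[m,n]∣m; gcd[m,n]∣n; gcd[m,n]≢0)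
open import Data.Nat.Coprimality as Coprime
  using (Coprime; coprime-/gcd; gcd≡1⇒coprime; coprime⇒gcd≡1; coprime-factors; coprime-divisor)
open import Data.Nat.Coprimality using (1-coprimeTo; 0-coprimeTo-m⇒m≡1)
open import Data.Bool using (Bool; true; false; T; not; _∨_)
open import Data.Maybe using (just; fromMaybe)
open import Data.List using (List; []; _∷_; [_]; map; upTo; applyUpTo; filterᵇ; findᵇ; length; _++_; concatMap)
open import Data.List.Properties using (length-map; length-upTo; length-filter; length-++; length-++-sucʳ; map-upTo)
open import Data.List.Membership.Propositional using (_∈_; _∉_; lose)
open import Data.List.Membership.Propositional.Properties
  using (∈-map⁺; ∈-map⁻; ∈-upTo⁺; ∈-upTo⁻; ∈-filter⁺; ∈-filter⁻; ∈-∃++; ∈-++⁻; ∈-++⁺ˡ; ∈-++⁺ʳ; ∈-concatMap⁺; ∈-length)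
open import Data.List.Membership.Propositional.Properties.WithK using (unique∧set⇒bag)
open import Data.List.Membership.DecPropositional _≟_ using (_∈?_)
open import Data.List.Relation.Binary.BagAndSetEquality using (∼bag⇒↭)
open import Data.List.Relation.Binary.Permutation.Propositional using (_↭_)
open import Data.List.Relation.Binary.Sublist.Propositional using (_⊆_; []; _∷_; _∷ʳ_; lookup; from∈; minimum)
open import Data.List.Relation.Unary.Any using (here; there)
open import Data.List.Relation.Unary.All as All using ()
open import Data.List.Relation.Unary.All.Properties using (all⁺; all⁻)
open import Data.List.Relation.Unary.AllPairs using ([]; _∷_)
open import Data.List.Relation.Unary.Unique.Propositional using (Unique)
import Data.List.Relation.Unary.Unique.Propositional.Properties as Unique
open import Data.Product using (Σ; ∃-syntax; _×_; _,_; proj₁; proj₂)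
open import Data.Sum using (inj₁; inj₂)
open import Function using (_∘_; _⇔_)
open import Function.Bundles using (mk⇔; module Equivalence)
open import Relation.Nullary using (¬_; Dec; yes; no; contradiction)
open import Relation.Nullary.Decidable using (T?)
open import Relation.Binary.PropositionalEquality
  using (_≡_; _≢_; refl; sym; trans; cong; cong₂; subst; subst₂; module ≡-Reasoning)
open import Algebra.Properties.CommutativeSemigroup +-commutativeSemigroup
  using (xy∙z≈x∙zy) renaming (interchange to +-interchange)
open import Algebra.Properties.CommutativeSemigroup *-commutativeSemigroup
  using () renaming (interchange to *-interchange)

sum-map-cong : ∀ {f g : ℕ → ℕ} xs → (∀ {x} → x ∈ xs → f x ≡ g x) → sum (map f xs) ≡ sum (map g xs)
sum-map-cong []       f≗g = refl
sum-map-cong (x ∷ xs) f≗g = cong₂ _+_ (f≗g (here refl)) (sum-map-cong xs (f≗g ∘ there))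

sum-map-+ : ∀ (f g : ℕ → ℕ) xs → sum (map (λ x → f x + g x) xs) ≡ sum (map f xs) + sum (map g xs)
sum-map-+ f g []       = refl
sum-map-+ f g (x ∷ xs) =
  trans (cong (f x + g x +_) (sum-map-+ f g xs)) (+-interchange (f x) (g x) _ _)

≤-sum-map : ∀ (f : ℕ → ℕ) {x xs} → x ∈ xs → f x ≤ sum (map f xs)
≤-sum-map f {xs = y ∷ xs} (here refl) = m≤m+n (f y) _
≤-sum-map f {xs = y ∷ xs} (there x∈xs) = ≤-trans (≤-sum-map f x∈xs) (m≤n+m _ (f y))

length-concatMap : ∀ (f : ℕ → List ℕ) xs → length (concatMap f xs) ≡ sum (map (length ∘ f) xs)
length-concatMap f []       = refl
length-concatMap f (x ∷ xs) = trans (length-++ (f x)) (cong (length (f x) +_) (length-concatMap f xs))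

unique∧⊆⇒length≤ : ∀ {xs ys : List ℕ} → Unique xs → (∀ {x} → x ∈ xs → x ∈ ys) →
                   length xs ≤ length ys
unique∧⊆⇒length≤ {[]}     _            _     = z≤n
unique∧⊆⇒length≤ {x ∷ xs} (x∉xs ∷ xs!) xs⊆ys with as , bs , refl ← ∈-∃++ (xs⊆ys (here refl)) =
  ≤-trans (s≤s (unique∧⊆⇒length≤ xs! xs⊆as++bs)) (≤-reflexive (sym (length-++-sucʳ as x bs)))
  where
  xs⊆as++bs : ∀ {y} → y ∈ xs → y ∈ as ++ bs
  xs⊆as++bs y∈xs with ∈-++⁻ as (xs⊆ys (there y∈xs))
  ... | inj₁ y∈as         = ∈-++⁺ˡ y∈as
  ... | inj₂ (here refl)  = contradiction refl (All.lookup x∉xs y∈xs)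
  ... | inj₂ (there y∈bs) = ∈-++⁺ʳ as y∈bs

unique∧⊆∧length≥⇒⊇ : ∀ {xs ys : List ℕ} → Unique xs → (∀ {x} → x ∈ xs → x ∈ ys) →
                     length ys ≤ length xs → ∀ {y} → y ∈ ys → y ∈ xs
unique∧⊆∧length≥⇒⊇ {xs} {ys} xs! xs⊆ys |ys|≤|xs| {y} y∈ys with y ∈? xs
... | yes y∈xs = y∈xs
... | no  y∉xs = contradiction |ys|≤|xs| (<⇒≱ (unique∧⊆⇒length≤ y∷xs! y∷xs⊆ys))
  where
  y∷xs! : Unique (y ∷ xs)
  y∷xs! = All.tabulate (λ x∈xs y≡x → y∉xs (subst (_∈ xs) (sym y≡x) x∈xs)) ∷ xs!
  y∷xs⊆ys : ∀ {x} → x ∈ y ∷ xs → x ∈ ys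
  y∷xs⊆ys (here refl)  = y∈ys
  y∷xs⊆ys (there x∈xs) = xs⊆ys x∈xs

unique-map⁺ : ∀ (f : ℕ → ℕ) {xs} → Unique xs →
              (∀ {x y} → x ∈ xs → y ∈ xs → f x ≡ f y → x ≡ y) → Unique (map f xs)
unique-map⁺ f {[]}     []           _      = []
unique-map⁺ f {x ∷ xs} (x∉xs ∷ xs!) f-inj =
  All.tabulate fx∉fxs ∷ unique-map⁺ f xs! (λ p q → f-inj (there p) (there q))
  where
  fx∉fxs : ∀ {z} → z ∈ map f xs → f x ≢ z
  fx∉fxs z∈fxs fx≡z with y , y∈xs , refl ← ∈-map⁻ f z∈fxs =
    All.lookup x∉xs y∈xs (f-inj (here refl) (there y∈xs) fx≡z)

∈-range1⁻ : ∀ {x} n → x ∈ range1 n → 1 ≤ x × x ≤ n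
∈-range1⁻ n x∈ with y , y∈ , refl ← ∈-map⁻ suc x∈ = s≤s z≤n , ∈-upTo⁻ y∈

∈-range1⁺ : ∀ {x} n → 1 ≤ x → x ≤ n → x ∈ range1 n
∈-range1⁺ n (s≤s z≤n) x≤n = ∈-map⁺ suc (∈-upTo⁺ x≤n)

range1-unique : ∀ n → Unique (range1 n)
range1-unique n = Unique.map⁺ suc-injective (Unique.upTo⁺ n)

length-range1 : ∀ n → length (range1 n) ≡ n
length-range1 n = trans (length-map suc (upTo n)) (length-upTo n)

∈-divisors⁻ : ∀ {g} n → g ∈ divisors n → 1 ≤ g × g ∣ n
∈-divisors⁻ n g∈ with g∈range , g∣n ← ∈-filter⁻ (_∣? n) {xs = range1 n} g∈ =
  proj₁ (∈-range1⁻ n g∈range) , g∣n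

∈-divisors⁺ : ∀ {g} n .{{_ : NonZero n}} → 1 ≤ g → g ∣ n → g ∈ divisors n
∈-divisors⁺ n 1≤g g∣n = ∈-filter⁺ (_∣? n) (∈-range1⁺ n 1≤g (∣⇒≤ g∣n)) g∣n

divisors-unique : ∀ n → Unique (divisors n)
divisors-unique n = Unique.filter⁺ (_∣? n) (range1-unique n)

totatives : ℕ → List ℕ
totatives d = filterᵇ (λ k → coprimeᵇ k d) (range1 d)

∈-totatives⁻ : ∀ {x} d → x ∈ totatives d → x ∈ range1 d × Coprime x d
∈-totatives⁻ {x} d x∈ with x∈range , x⊥d ← ∈-filter⁻ (T? ∘ λ k → coprimeᵇ k d) {xs = range1 d} x∈ =
  x∈range , gcd≡1⇒coprime (≡ᵇ⇒≡ (gcd x d) 1 x⊥d)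

∈-totatives⁺ : ∀ {x} d → x ∈ range1 d → Coprime x d → x ∈ totatives d
∈-totatives⁺ {x} d x∈range x⊥d =
  ∈-filter⁺ (T? ∘ λ k → coprimeᵇ k d) x∈range (≡⇒≡ᵇ (gcd x d) 1 (coprime⇒gcd≡1 x⊥d))

totatives-unique : ∀ d → Unique (totatives d)
totatives-unique d = Unique.filter⁺ (T? ∘ λ k → coprimeᵇ k d) (range1-unique d)

div≡/ : ∀ m n .{{_ : NonZero n}} → m div n ≡ m / n
div≡/ m (suc n) = refl

-- k / n = u / g in lowest terms, with g = n / gcd(k, n) and u = k / gcd(k, n)
lowestTerms : ∀ {k} n → k ∈ range1 n →
              ∃[ g ] g ∈ divisors n × ∃[ u ] u ∈ totatives g × k ≡ u * (n div g)
lowestTerms {k} n k∈ = g , g∈divisors , u , u∈totatives , k≡u*[n/g]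
  where
  1≤k : 1 ≤ k
  1≤k = proj₁ (∈-range1⁻ n k∈)
  k≤n : k ≤ n
  k≤n = proj₂ (∈-range1⁻ n k∈)
  instance
    n≢0 : NonZero n
    n≢0 = >-nonZero (≤-trans 1≤k k≤n)
    G≢0 : NonZero (gcd k n)
    G≢0 = ≢-nonZero (gcd[m,n]≢0 k n (inj₂ (≢-nonZero⁻¹ n)))
  G g u : ℕ
  G = gcd k n
  g = n / G
  u = k / G
  g*G≡n : g * G ≡ n
  g*G≡n = m/n*n≡m (gcd[m,n]∣n k n)
  u*G≡k : u * G ≡ k
  u*G≡k = m/n*n≡m (gcd[m,n]∣m k n)
  instance
    g≢0 : NonZero g
    g≢0 = ≢-nonZero λ g≡0 → ≢-nonZero⁻¹ n (trans (sym g*G≡n) (cong (_* G) g≡0))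
  1≤u : 1 ≤ u
  1≤u = n≢0⇒n>0 λ u≡0 → <⇒≢ 1≤k (trans (cong (_* G) (sym u≡0)) u*G≡k)
  g∈divisors : g ∈ divisors n
  g∈divisors = ∈-divisors⁺ n (>-nonZero⁻¹ g) (divides G (trans (sym g*G≡n) (*-comm g G)))
  u≤g : u ≤ g
  u≤g = *-cancelʳ-≤ u g G (subst₂ _≤_ (sym u*G≡k) (sym g*G≡n) k≤n)
  u∈totatives : u ∈ totatives g
  u∈totatives = ∈-totatives⁺ g (∈-range1⁺ g 1≤u u≤g) (coprime-/gcd k n)
  k≡u*[n/g] : k ≡ u * (n div g)
  k≡u*[n/g] = begin
    k                ≡⟨ u*G≡k ⟨
    u * G            ≡⟨ cong (u *_) (m*n/n≡m G g) ⟨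
    u * (G * g / g)  ≡⟨ cong (λ x → u * (x / g)) (trans (*-comm G g) g*G≡n) ⟩
    u * (n / g)      ≡⟨ cong (u *_) (div≡/ n g) ⟨
    u * (n div g)    ∎
    where open ≡-Reasoning

n≤∑φ : ∀ n → n ≤ sum (map φ (divisors n))
n≤∑φ n = begin
  n                                            ≡⟨ length-range1 n ⟨
  length (range1 n)                            ≤⟨ unique∧⊆⇒length≤ (range1-unique n) range1⊆fractions ⟩
  length (concatMap fractions (divisors n))    ≡⟨ length-concatMap fractions (divisors n) ⟩
  sum (map (length ∘ fractions) (divisors n))  ≡⟨ sum-map-cong (divisors n) (λ {g} _ → length-map _ (totatives g)) ⟩
  sum (map φ (divisors n))                     ∎
  where
  open ≤-Reasoning
  fractions : ℕ → List ℕ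
  fractions g = map (_* (n div g)) (totatives g)
  range1⊆fractions : ∀ {k} → k ∈ range1 n → k ∈ concatMap fractions (divisors n)
  range1⊆fractions k∈ with g , g∈ , u , u∈ , refl ← lowestTerms n k∈ =
    ∈-concatMap⁺ fractions (lose g∈ (∈-map⁺ (_* (n div g)) u∈))

module _ {d : ℕ} .{{_ : NonZero d}} where

  *-congˡ-% : ∀ m {n n′} → n % d ≡ n′ % d → (m * n) % d ≡ (m * n′) % d
  *-congˡ-% m {n} {n′} eq = begin
    (m * n) % d               ≡⟨ %-distribˡ-* m n d ⟩
    (m % d * (n % d)) % d     ≡⟨ cong (λ x → (m % d * x) % d) eq ⟩
    (m % d * (n′ % d)) % d    ≡⟨ %-distribˡ-* m n′ d ⟨
    (m * n′) % d              ∎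
    where open ≡-Reasoning

  *-congʳ-% : ∀ {m m′} n → m % d ≡ m′ % d → (m * n) % d ≡ (m′ * n) % d
  *-congʳ-% {m} {m′} n eq = begin
    (m * n) % d   ≡⟨ cong (_% d) (*-comm m n) ⟩
    (n * m) % d   ≡⟨ *-congˡ-% n eq ⟩
    (n * m′) % d  ≡⟨ cong (_% d) (*-comm n m′) ⟩
    (m′ * n) % d  ∎
    where open ≡-Reasoning

  ^-%≡1 : ∀ {m} q → m % d ≡ 1 % d → (m ^ q) % d ≡ 1 % d
  ^-%≡1 zero    m≡1 = refl
  ^-%≡1 {m} (suc q) m≡1 = begin
    (m * m ^ q) % d  ≡⟨ *-congʳ-% (m ^ q) m≡1 ⟩
    (1 * m ^ q) % d  ≡⟨ cong (_% d) (*-identityˡ (m ^ q)) ⟩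
    (m ^ q) % d      ≡⟨ ^-%≡1 q m≡1 ⟩
    1 % d            ∎
    where open ≡-Reasoning

  product-map-% : ∀ {f g : ℕ → ℕ} xs → (∀ {x} → x ∈ xs → f x % d ≡ g x % d) →
                  product (map f xs) % d ≡ product (map g xs) % d
  product-map-% []               f≡g = refl
  product-map-% {f} {g} (x ∷ xs) f≡g = begin
    (f x * product (map f xs)) % d  ≡⟨ *-congʳ-% _ (f≡g (here refl)) ⟩
    (g x * product (map f xs)) % d  ≡⟨ *-congˡ-% (g x) (product-map-% xs (f≡g ∘ there)) ⟩
    (g x * product (map g xs)) % d  ∎
    where open ≡-Reasoning

  %≡%⇒∣∸ : ∀ {m n} → m ≤ n → m % d ≡ n % d → d ∣ n ∸ m
  %≡%⇒∣∸ {m} {n} m≤n eq = divides (n / d ∸ m / d) (begin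
    n ∸ m                                      ≡⟨ cong₂ _∸_ (m≡m%n+[m/n]*n n d) (m≡m%n+[m/n]*n m d) ⟩
    (n % d + n / d * d) ∸ (m % d + m / d * d)  ≡⟨ cong (λ r → (n % d + n / d * d) ∸ (r + m / d * d)) eq ⟩
    (n % d + n / d * d) ∸ (n % d + m / d * d)  ≡⟨ [m+n]∸[m+o]≡n∸o (n % d) _ _ ⟩
    n / d * d ∸ m / d * d                      ≡⟨ *-distribʳ-∸ d (n / d) (m / d) ⟨
    (n / d ∸ m / d) * d                        ∎)
    where open ≡-Reasoning

  *-cancelˡ-%-≤ : ∀ {c m n} → Coprime c d → m % d ≤ n % d → (c * m) % d ≡ (c * n) % d → m % d ≡ n % d
  *-cancelˡ-%-≤ {c} {m} {n} c⊥d m≤n cm≡cn = ≤-antisym m≤n (m∸n≡0⇒m≤n n∸m≡0)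
    where
    d∣c*[n∸m] : d ∣ c * (n % d ∸ m % d)
    d∣c*[n∸m] = subst (d ∣_) (sym (*-distribˡ-∸ c (n % d) (m % d)))
      (%≡%⇒∣∸ (*-monoʳ-≤ c m≤n)
        (trans (*-congˡ-% c (m%n%n≡m%n m d)) (trans cm≡cn (sym (*-congˡ-% c (m%n%n≡m%n n d))))))
    n∸m≡0 : n % d ∸ m % d ≡ 0
    n∸m≡0 = trans (sym (m<n⇒m%n≡m (≤-<-trans (m∸n≤m (n % d) (m % d)) (m%n<n n d))))
                  (n∣m⇒m%n≡0 _ d (coprime-divisor (Coprime.sym c⊥d) d∣c*[n∸m]))

  *-cancelˡ-% : ∀ {c m n} → Coprime c d → (c * m) % d ≡ (c * n) % d → m % d ≡ n % d
  *-cancelˡ-% {c} {m} {n} c⊥d cm≡cn with ≤-total (m % d) (n % d)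
  ... | inj₁ m≤n = *-cancelˡ-%-≤ c⊥d m≤n cm≡cn
  ... | inj₂ n≤m = sym (*-cancelˡ-%-≤ c⊥d n≤m (sym cm≡cn))

coprime-* : ∀ {m n d} → Coprime m d → Coprime n d → Coprime (m * n) d
coprime-* {m} {n} m⊥d n⊥d (i∣mn , i∣d) = n⊥d (coprime-factors m⊥d (i∣mn , ∣m⇒∣m*n n i∣d) , i∣d)

coprime-product : ∀ {d} xs → (∀ {x} → x ∈ xs → Coprime x d) → Coprime (product xs) d
coprime-product {d} []       _     = 1-coprimeTo d
coprime-product     (x ∷ xs) xs⊥d = coprime-* (xs⊥d (here refl)) (coprime-product xs (xs⊥d ∘ there))

coprime-% : ∀ {m d} .{{_ : NonZero d}} → Coprime m d → Coprime (m % d) d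
coprime-% {m} {d} m⊥d (i∣m%d , i∣d) = m⊥d (∣n∣m%n⇒∣m i∣d i∣m%d , i∣d)

product-map-*ˡ : ∀ a xs → product (map (a *_) xs) ≡ a ^ length xs * product xs
product-map-*ˡ a []       = refl
product-map-*ˡ a (x ∷ xs) = trans (cong (a * x *_) (product-map-*ˡ a xs)) (*-interchange a x _ _)

module Euler (d : ℕ) .{{_ : NonZero d}} (1<d : 1 < d) {a : ℕ} (a⊥d : Coprime a d) where

  totative<d : ∀ {x} → x ∈ totatives d → x < d
  totative<d {x} x∈ with x∈range , x⊥d ← ∈-totatives⁻ d x∈ =
    ≤∧≢⇒< (proj₂ (∈-range1⁻ d x∈range)) λ { refl → <⇒≢ 1<d (sym (x⊥d (∣-refl , ∣-refl))) }

  mul : ℕ → ℕ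
  mul x = (a * x) % d

  mul-totative : ∀ {x} → x ∈ totatives d → mul x ∈ totatives d
  mul-totative x∈ = ∈-totatives⁺ d (∈-range1⁺ d 1≤ax (m%n≤n _ d)) ax⊥d
    where
    ax⊥d : Coprime (mul _) d
    ax⊥d = coprime-% (coprime-* a⊥d (proj₂ (∈-totatives⁻ d x∈)))
    1≤ax : 1 ≤ mul _
    1≤ax = n≢0⇒n>0 λ ax≡0 → <⇒≢ 1<d (sym (0-coprimeTo-m⇒m≡1 (subst (λ y → Coprime y d) ax≡0 ax⊥d)))

  mul-injective : ∀ {x y} → x ∈ totatives d → y ∈ totatives d → mul x ≡ mul y → x ≡ y
  mul-injective x∈ y∈ eq = begin
    _  ≡⟨ m<n⇒m%n≡m (totative<d x∈) ⟨
    _  ≡⟨ *-cancelˡ-% a⊥d eq ⟩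
    _  ≡⟨ m<n⇒m%n≡m (totative<d y∈) ⟩
    _  ∎
    where open ≡-Reasoning

  mul-permutes : map mul (totatives d) ↭ totatives d
  mul-permutes = ∼bag⇒↭ (unique∧set⇒bag mulU! (totatives-unique d) (mk⇔ mulU⊆U U⊆mulU))
    where
    mulU! : Unique (map mul (totatives d))
    mulU! = unique-map⁺ mul (totatives-unique d) mul-injective
    mulU⊆U : ∀ {y} → y ∈ map mul (totatives d) → y ∈ totatives d
    mulU⊆U y∈ with x , x∈ , refl ← ∈-map⁻ mul y∈ = mul-totative x∈
    U⊆mulU : ∀ {y} → y ∈ totatives d → y ∈ map mul (totatives d)
    U⊆mulU = unique∧⊆∧length≥⇒⊇ mulU! mulU⊆U (≤-reflexive (sym (length-map mul (totatives d))))

  a^φ%d≡1 : (a ^ φ d) % d ≡ 1 % d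
  a^φ%d≡1 = *-cancelˡ-% (coprime-product U (proj₂ ∘ ∈-totatives⁻ d)) (begin
    (P * a ^ φ d) % d             ≡⟨ cong (_% d) (trans (*-comm P _) (sym (product-map-*ˡ a U))) ⟩
    product (map (a *_) U) % d    ≡⟨ product-map-% U (λ {x} _ → sym (m%n%n≡m%n (a * x) d)) ⟩
    product (map mul U) % d       ≡⟨ cong (_% d) (product-↭ mul-permutes) ⟩
    P % d                         ≡⟨ cong (_% d) (*-identityʳ P) ⟨
    (P * 1) % d                   ∎)
    where
    open ≡-Reasoning
    U : List ℕ
    U = totatives d
    P : ℕ
    P = product U

euler : ∀ d .{{_ : NonZero d}} {a} → Coprime a d → (a ^ φ d) % d ≡ 1 % d
euler 1               {a} _   = trans (n%1≡0 (a ^ φ 1)) (sym (n%1≡0 1))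
euler d@(suc (suc _))     a⊥d = Euler.a^φ%d≡1 d (s≤s (s≤s z≤n)) a⊥d

IsUniversalExponent : (d : ℕ) .{{_ : NonZero d}} → ℕ → Set
IsUniversalExponent d m = ∀ {a} → a ∈ range1 d → Coprime a d → (a ^ m) % d ≡ 1 % d

carmichaelExp⇔ : ∀ d .{{_ : NonZero d}} m → T (carmichaelExp d m) ⇔ IsUniversalExponent d m
carmichaelExp⇔ d@(suc _) m = mk⇔ sound complete
  where
  test : ℕ → Bool
  test a = not (coprimeᵇ a d) ∨ ((a ^ m) mod d ≡ᵇ 1 mod d)
  sound : T (carmichaelExp d m) → IsUniversalExponent d m
  sound t {a} a∈ a⊥d = ≡ᵇ⇒≡ _ _
    (subst (λ g → T (not (g ≡ᵇ 1) ∨ ((a ^ m) mod d ≡ᵇ 1 mod d))) (coprime⇒gcd≡1 a⊥d)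
           (All.lookup (all⁺ test (range1 d) t) a∈))
  passes : IsUniversalExponent d m → ∀ {a} → a ∈ range1 d → T (test a)
  passes u {a} a∈ with gcd a d ≡ᵇ 1 in eq
  ... | false = _
  ... | true  = ≡⇒≡ᵇ _ _ (u a∈ (gcd≡1⇒coprime (≡ᵇ⇒≡ _ _ (subst T (sym eq) _))))
  complete : IsUniversalExponent d m → T (carmichaelExp d m)
  complete u = all⁻ test (All.tabulate (passes u))

findᵇ-applyUpTo : ∀ (p : ℕ → Bool) (f : ℕ → ℕ) {n j} → j < n → T (p (f j)) →
  ∃[ i ] findᵇ p (applyUpTo f n) ≡ just (f i) × T (p (f i)) × (∀ {i′} → i′ < i → ¬ T (p (f i′)))
findᵇ-applyUpTo p f {suc n} {j} j<n pfj with p (f 0) in eq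
... | true = 0 , refl , subst T (sym eq) _ , λ ()
... | false with j
...   | zero  = contradiction (subst T eq pfj) λ ()
...   | suc j′ with i , found , pfi , below ← findᵇ-applyUpTo p (f ∘ suc) (≤-pred j<n) pfj =
  suc i , found , pfi , minimal
  where
  minimal : ∀ {i′} → i′ < suc i → ¬ T (p (f i′))
  minimal {zero}   _          = subst T eq
  minimal {suc i′} (s≤s i′<i) = below i′<i

1≤φ : ∀ d .{{_ : NonZero d}} → 1 ≤ φ d
1≤φ d = ∈-length (∈-totatives⁺ d (∈-range1⁺ d (s≤s z≤n) (>-nonZero⁻¹ d)) (1-coprimeTo d))

φ[d]≤d : ∀ d → φ d ≤ d
φ[d]≤d d = ≤-trans (length-filter (T? ∘ λ k → coprimeᵇ k d) (range1 d)) (≤-reflexive (length-range1 d))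

universalExponent-% : ∀ {d} .{{_ : NonZero d}} {F L} .{{_ : NonZero L}} →
  IsUniversalExponent d F → IsUniversalExponent d L → IsUniversalExponent d (F % L)
universalExponent-% {d} {F} {L} F-univ L-univ {a} a∈ a⊥d = begin
  (a ^ r) % d                    ≡⟨ cong (_% d) (*-identityʳ (a ^ r)) ⟨
  (a ^ r * 1) % d                ≡⟨ *-congˡ-% (a ^ r) (^-%≡1 q (L-univ a∈ a⊥d)) ⟨
  (a ^ r * (a ^ L) ^ q) % d      ≡⟨ cong (λ x → (a ^ r * x) % d) (^-*-assoc a L q) ⟩
  (a ^ r * a ^ (L * q)) % d      ≡⟨ cong (λ e → (a ^ r * a ^ e) % d) (*-comm L q) ⟩
  (a ^ r * a ^ (q * L)) % d      ≡⟨ cong (_% d) (^-distribˡ-+-* a r (q * L)) ⟨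
  (a ^ (r + q * L)) % d          ≡⟨ cong (λ e → (a ^ e) % d) (m≡m%n+[m/n]*n F L) ⟨
  (a ^ F) % d                    ≡⟨ F-univ a∈ a⊥d ⟩
  1 % d                          ∎
  where
  open ≡-Reasoning
  r q : ℕ
  r = F % L
  q = F / L

φ-universal : ∀ d .{{_ : NonZero d}} → IsUniversalExponent d (φ d)
φ-universal d _ = euler d

-- the search defining λ(d) succeeds because φ(d) ≤ d is a universal exponent
λc-minimal : ∀ d .{{_ : NonZero d}} →
  ∃[ i ] λc d ≡ suc i × IsUniversalExponent d (suc i) ×
         (∀ {m} → 1 ≤ m → m < suc i → ¬ IsUniversalExponent d m)
λc-minimal d with φ d | 1≤φ d | φ[d]≤d d | φ-universal d
... | suc j | _ | j<d | φ-univ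
  with i , found , passes , below
         ← findᵇ-applyUpTo (carmichaelExp d) suc j<d (Equivalence.from (carmichaelExp⇔ d (suc j)) φ-univ) =
  i , λc≡1+i , Equivalence.to (carmichaelExp⇔ d (suc i)) passes ,
  λ { {suc m} _ m<1+i → below (≤-pred m<1+i) ∘ Equivalence.from (carmichaelExp⇔ d (suc m)) }
  where
  λc≡1+i : λc d ≡ suc i
  λc≡1+i = cong (fromMaybe 0) (trans (cong (findᵇ (carmichaelExp d)) (map-upTo suc d)) found)

1≤λc : ∀ d .{{_ : NonZero d}} → 1 ≤ λc d
1≤λc d with i , λc≡1+i , _ ← λc-minimal d = subst (1 ≤_) (sym λc≡1+i) (s≤s z≤n)

-- F mod λ(d) is again a universal exponent, so by minimality it vanishes
λc∣universalExponent : ∀ d .{{_ : NonZero d}} {F} → IsUniversalExponent d F → λc d ∣ F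
λc∣universalExponent d {F} F-univ with i , λc≡1+i , λ-univ , minimal ← λc-minimal d
  rewrite λc≡1+i = m%n≡0⇒n∣m F (suc i) (n≤0⇒n≡0 (≮⇒≥ remainder-not-positive))
  where
  remainder-not-positive : ¬ 0 < F % suc i
  remainder-not-positive 0<r =
    minimal 0<r (m%n<n F (suc i)) (universalExponent-% {F = F} {L = suc i} F-univ λ-univ)

λc*[φ/λc]≡φ : ∀ d .{{_ : NonZero d}} → λc d * (φ d div λc d) ≡ φ d
λc*[φ/λc]≡φ d with λc d | 1≤λc d | λc∣universalExponent d (φ-universal d)
... | suc _ | _ | λ∣φ = m*[n/m]≡n λ∣φ

indicator : List ℕ → ℕ → ℕ
indicator D d with d ∈? D
... | yes _ = 1
... | no  _ = 0

indicator≤1 : ∀ D d → indicator D d ≤ 1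
indicator≤1 D d with d ∈? D
... | yes _ = s≤s z≤n
... | no  _ = z≤n

indicator-∈ : ∀ {D d} → d ∈ D → indicator D d ≡ 1
indicator-∈ {D} {d} d∈D with d ∈? D
... | yes _   = refl
... | no  d∉D = contradiction d∈D d∉D

indicator-∉ : ∀ {D d} → d ∉ D → indicator D d ≡ 0
indicator-∉ {D} {d} d∉D with d ∈? D
... | yes d∈D = contradiction d∈D d∉D
... | no  _   = refl

indicator-∷-≢ : ∀ {x D d} → d ≢ x → indicator (x ∷ D) d ≡ indicator D d
indicator-∷-≢ {x} {D} {d} d≢x = by-cases (d ∈? D)
  where
  by-cases : Dec (d ∈ D) → indicator (x ∷ D) d ≡ indicator D d
  by-cases (yes d∈D) = trans (indicator-∈ (there d∈D)) (sym (indicator-∈ d∈D))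
  by-cases (no d∉D)  =
    trans (indicator-∉ λ { (here d≡x) → d≢x d≡x ; (there d∈D) → d∉D d∈D }) (sym (indicator-∉ d∉D))

indicator-[]-comm : ∀ e d → indicator [ e ] d ≡ indicator [ d ] e
indicator-[]-comm e d = by-cases (d ≟ e)
  where
  by-cases : Dec (d ≡ e) → indicator [ e ] d ≡ indicator [ d ] e
  by-cases (yes d≡e) = trans (indicator-∈ (here d≡e)) (sym (indicator-∈ (here (sym d≡e))))
  by-cases (no d≢e)  =
    trans (indicator-∉ λ { (here d≡e) → d≢e d≡e }) (sym (indicator-∉ λ { (here e≡d) → d≢e (sym e≡d) }))

sum-map-*-indicator : ∀ (w : ℕ → ℕ) {D L} → D ⊆ L → Unique L →
                      sum (map (λ d → w d * indicator D d) L) ≡ sum (map w D)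
sum-map-*-indicator w []           []          = refl
sum-map-*-indicator w {D} {y ∷ L} (.y ∷ʳ D⊆L) (y∉L ∷ L!) = begin
  w y * indicator D y + ∑L  ≡⟨ cong (λ i → w y * i + ∑L) (indicator-∉ y∉D) ⟩
  w y * 0 + ∑L              ≡⟨ cong (_+ ∑L) (*-zeroʳ (w y)) ⟩
  ∑L                        ≡⟨ sum-map-*-indicator w D⊆L L! ⟩
  sum (map w D)             ∎
  where
  open ≡-Reasoning
  ∑L : ℕ
  ∑L = sum (map (λ d → w d * indicator D d) L)
  y∉D : y ∉ D
  y∉D y∈D = All.lookup y∉L (lookup D⊆L y∈D) refl
sum-map-*-indicator w {x ∷ D} {.x ∷ L} (refl ∷ D⊆L) (x∉L ∷ L!) = cong₂ _+_
  (trans (cong (w x *_) (indicator-∈ (here refl))) (*-identityʳ (w x)))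
  (begin
    sum (map (λ d → w d * indicator (x ∷ D) d) L)
      ≡⟨ sum-map-cong L (λ d∈L → cong (w _ *_) (indicator-∷-≢ (All.lookup x∉L d∈L ∘ sym))) ⟩
    sum (map (λ d → w d * indicator D d) L)        ≡⟨ sum-map-*-indicator w D⊆L L! ⟩
    sum (map w D)                                  ∎)
  where open ≡-Reasoning

module Representations (w : ℕ → ℕ) (L : List ℕ) (L! : Unique L) where

  Representable : (ℕ → ℕ) → ℕ → Set
  Representable b m =
    Σ (ℕ → ℕ) λ c → ((d : ℕ) → d ∈ L → c d ≤ b d) × (m ≡ sum (map (λ d → w d * c d) L))

  Covers : (ℕ → ℕ) → ℕ → Set
  Covers b T = ∀ m → m ≤ T → Representable b m

  covers-mono : ∀ {b b′ T T′} → (∀ d → d ∈ L → b d ≤ b′ d) → T′ ≤ T → Covers b T → Covers b′ T′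
  covers-mono b≤b′ T′≤T cover m m≤T′ with c , c≤b , m≡ ← cover m (≤-trans m≤T′ T′≤T) =
    c , (λ d d∈L → ≤-trans (c≤b d d∈L) (b≤b′ d d∈L)) , m≡

  representable-sublist : ∀ {D} → D ⊆ L → Representable (λ _ → 1) (sum (map w D))
  representable-sublist {D} D⊆L = indicator D , (λ d _ → indicator≤1 D d) , sym (sum-map-*-indicator w D⊆L L!)

  representable-+ : ∀ {b m e} → e ∈ L → Representable b m →
                    Representable (λ d → b d + indicator [ e ] d) (m + w e)
  representable-+ {b} {m} {e} e∈L (c , c≤b , m≡) =
    (λ d → c d + indicator [ e ] d) , (λ d d∈L → +-monoˡ-≤ _ (c≤b d d∈L)) , (begin
      m + w e
        ≡⟨ cong₂ _+_ m≡ (sym (+-identityʳ (w e))) ⟩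
      sum (map (λ d → w d * c d) L) + sum (map w [ e ])
        ≡⟨ cong (_ +_) (sum-map-*-indicator w (from∈ e∈L) L!) ⟨
      sum (map (λ d → w d * c d) L) + sum (map (λ d → w d * indicator [ e ] d) L)
        ≡⟨ sum-map-+ (λ d → w d * c d) (λ d → w d * indicator [ e ] d) L ⟨
      sum (map (λ d → w d * c d + w d * indicator [ e ] d) L)
        ≡⟨ sum-map-cong L (λ {d} _ → *-distribˡ-+ (w d) (c d) _) ⟨
      sum (map (λ d → w d * (c d + indicator [ e ] d)) L)
        ∎)
    where open ≡-Reasoning

  covers-step : ∀ {b T e} → e ∈ L → w e ≤ suc T → Covers b T →
                Covers (λ d → b d + indicator [ e ] d) (T + w e)
  -- since w e ≤ T + 1, every m > T is a representation of m ∸ w e ≤ T plus one copy of w e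
  covers-step {b} {T} {e} e∈L we≤1+T cover m m≤T+we with m ≤? T
  ... | yes m≤T = covers-mono (λ d _ → m≤m+n (b d) _) ≤-refl cover m m≤T
  ... | no  m≰T = subst (Representable _) (m∸n+n≡m we≤m) (representable-+ e∈L (cover (m ∸ w e) m∸we≤T))
    where
    we≤m : w e ≤ m
    we≤m = ≤-trans we≤1+T (≰⇒> m≰T)
    m∸we≤T : m ∸ w e ≤ T
    m∸we≤T = m≤n+o⇒m∸n≤o m (w e) (subst (m ≤_) (+-comm T (w e)) m≤T+we)

  covers-repeat : ∀ {b T e} → e ∈ L → w e ≤ suc T → Covers b T →
                  ∀ j → Covers (λ d → b d + j * indicator [ e ] d) (T + j * w e)
  covers-repeat {b} {T} {e} e∈L we≤1+T cover zero =
    covers-mono (λ d _ → m≤m+n (b d) 0) (≤-reflexive (+-identityʳ T)) cover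
  covers-repeat {b} {T} {e} e∈L we≤1+T cover (suc j) =
    covers-mono (λ d _ → ≤-reflexive (xy∙z≈x∙zy (b d) (j * indicator [ e ] d) _))
                (≤-reflexive (sym (xy∙z≈x∙zy T (j * w e) (w e))))
                (covers-step e∈L (≤-trans we≤1+T (s≤s (m≤m+n T _))) (covers-repeat e∈L we≤1+T cover j))

  covers-raise : ∀ {b T} (j : ℕ → ℕ) es → (∀ {e} → e ∈ es → e ∈ L) → (∀ {e} → e ∈ es → w e ≤ suc T) →
                 Covers b T →
                 Covers (λ d → b d + sum (map (λ e → j e * indicator [ e ] d) es))
                        (T + sum (map (λ e → j e * w e) es))
  covers-raise {b} {T} j []       _        _      cover =
    covers-mono (λ d _ → m≤m+n (b d) 0) (≤-reflexive (+-identityʳ T)) cover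
  covers-raise {b} {T} j (e ∷ es) es⊆L small cover =
    covers-mono (λ d _ → ≤-reflexive (xy∙z≈x∙zy (b d) _ (j e * indicator [ e ] d)))
                (≤-reflexive (sym (xy∙z≈x∙zy T _ (j e * w e))))
                (covers-repeat (es⊆L (here refl)) (≤-trans (small (here refl)) (s≤s (m≤m+n T _)))
                  (covers-raise j es (es⊆L ∘ there) (small ∘ there) cover) (j e))

  covers-scale : ∀ (k : ℕ → ℕ) → (∀ d → d ∈ L → 1 ≤ k d) → Covers (λ _ → 1) (sum (map w L)) →
                 Covers k (sum (map (λ d → w d * k d) L))
  covers-scale k 1≤k cover = covers-mono bound total (covers-raise j L (λ e∈L → e∈L) small cover)
    where
    open ≡-Reasoning
    j : ℕ → ℕ
    j d = k d ∸ 1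
    1+j≡k : ∀ {d} → d ∈ L → suc (j d) ≡ k d
    1+j≡k {d} d∈L = m+[n∸m]≡n (1≤k d d∈L)
    small : ∀ {e} → e ∈ L → w e ≤ suc (sum (map w L))
    small e∈L = ≤-trans (≤-sum-map w e∈L) (n≤1+n _)
    bound : ∀ d → d ∈ L → 1 + sum (map (λ e → j e * indicator [ e ] d) L) ≤ k d
    bound d d∈L = ≤-reflexive (begin
      1 + sum (map (λ e → j e * indicator [ e ] d) L)
        ≡⟨ cong (1 +_) (sum-map-cong L (λ {e} _ → cong (j e *_) (indicator-[]-comm e d))) ⟩
      1 + sum (map (λ e → j e * indicator [ d ] e) L)  ≡⟨ cong (1 +_) (sum-map-*-indicator j (from∈ d∈L) L!) ⟩
      1 + (j d + 0)                                    ≡⟨ cong suc (+-identityʳ (j d)) ⟩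
      suc (j d)                                        ≡⟨ 1+j≡k d∈L ⟩
      k d                                              ∎)
    total : sum (map (λ d → w d * k d) L) ≤ sum (map w L) + sum (map (λ e → j e * w e) L)
    total = ≤-reflexive (begin
      sum (map (λ d → w d * k d) L)            ≡⟨ sum-map-cong L (λ {d} d∈L → begin
          w d * k d                                 ≡⟨ cong (w d *_) (1+j≡k d∈L) ⟨
          w d * suc (j d)                           ≡⟨ *-suc (w d) (j d) ⟩
          w d + w d * j d                           ≡⟨ cong (w d +_) (*-comm (w d) (j d)) ⟩
          w d + j d * w d                           ∎) ⟩
      sum (map (λ d → w d + j d * w d) L)      ≡⟨ sum-map-+ w (λ d → j d * w d) L ⟩
      sum (map w L) + sum (map (λ e → j e * w e) L) ∎)

1≤φ/λc : ∀ d .{{_ : NonZero d}} → 1 ≤ φ d div λc d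
1≤φ/λc d = n≢0⇒n>0 λ q≡0 → <⇒≢ (1≤φ d) (sym (begin
  φ d                     ≡⟨ λc*[φ/λc]≡φ d ⟨
  λc d * (φ d div λc d)   ≡⟨ cong (λc d *_) q≡0 ⟩
  λc d * 0                ≡⟨ *-zeroʳ (λc d) ⟩
  0                       ∎))
  where open ≡-Reasoning

corollary5p6 : (n : ℕ) → 1 ≤ n → λ⋆-practical n → λ-practical n
corollary5p6 n _ λ⋆ m _ m≤n = covers-scale k 1≤k λ⋆-covers m (≤-trans m≤n n≤∑λk)
  where
  open Representations λc (divisors n) (divisors-unique n)
  divisor≢0 : ∀ {d} → d ∈ divisors n → NonZero d
  divisor≢0 d∈ = >-nonZero (proj₁ (∈-divisors⁻ n d∈))
  k : ℕ → ℕ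
  k d = φ d div λc d
  1≤k : ∀ d → d ∈ divisors n → 1 ≤ k d
  1≤k d d∈ = 1≤φ/λc d {{divisor≢0 d∈}}
  λ⋆-covers : Covers (λ _ → 1) (Sλ n)
  λ⋆-covers zero    _   = representable-sublist (minimum _)
  λ⋆-covers (suc m) m≤S with D , D⊆ , ∑D≡m ← λ⋆ (suc m) (s≤s z≤n) m≤S =
    subst (Representable _) ∑D≡m (representable-sublist D⊆)
  n≤∑λk : n ≤ sum (map (λ d → λc d * k d) (divisors n))
  n≤∑λk = subst (n ≤_) (sum-map-cong (divisors n) λ {d} d∈ → sym (λc*[φ/λc]≡φ d {{divisor≢0 d∈}}))
                (n≤∑φ n)
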